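{- For all integers $m,n\ge1$ and all $\lambda\in\mathbb{C}$ with $\lambda\neq0$ and $\lambda^m\neq1$, \[ H_{n-1}^{(n)}(x|\lambda)=\left(\frac{1-\lambda}{1-\lambda^m}\right)^n\lambda^{mn}\sum_{s=0}^{n-1}\sum_{k=0}^{s}\binom{s}{k}\binom{n-1}{s}(-n)^{s-k}m^{n-1-s}\,S_k^{(n)}(m|\lambda)\,H_{n-1-s}^{(n)}\!\left(\frac{x}{m}\,\middle|\,\lambda^m\right). \]
   Context: For $\mu\in\mathbb{C}$, $\mu\neq1$, the higher-order Frobenius–Euler polynomials are defined by $\left(\frac{1-\mu}{e^t-\mu}\right)^{n}e^{xt}=\sum_{j\ge0}H_j^{(n)}(x|\mu)\frac{t^j}{j!}$. For integers $n\ge0$, $m\ge1$, $k\ge0$ and $\lambda\ne0$, the $\lambda$-analogue of the multiple power sum is \[S_k^{(n)}(m|\lambda)=\sum_{\substack{0\le v_1,\dots,v_m\le n\\ v_1+\cdots+v_m=n}}\binom{n}{v_1,\dots,v_m}\lambda^{ -(v_1+2v_2+\cdots+mv_m)}(v_1+2v_2+\cdots+mv_m)^k,\] with $\binom{n}{v_1,\dots,v_m}$ the multinomial coefficient. -}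

module Defs where

open import Level using (Level; _⊔_) renaming (suc to lsuc)
open import Algebra.Bundles using (CommutativeRing)
open import Relation.Nullary using (¬_)
open import Data.Nat as ℕ using (ℕ; zero; suc; _∸_; NonZero)
open import Data.Nat.Properties using (_!≢0; m*n≢0)
open import Data.Nat.Combinatorics using (_C_)
open import Data.Fin using (Fin; toℕ)
open import Data.Vec using (Vec; []; _∷_; lookup; _∷ʳ_)
open import Data.List using (List; []; _∷_; map; concatMap; upTo)

-- A field: a commutative ring with 0 ≠ 1 and a (total) inverse operation
-- which is a multiplicative inverse on every nonzero element
-- (the value of 0⁻¹ is irrelevant and never used).
record Field (c ℓ : Level) : Set (lsuc (c ⊔ ℓ)) where
  field
    commutativeRing : CommutativeRing c ℓ
  open CommutativeRing commutativeRing public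
  infix 9 _⁻¹
  field
    _⁻¹       : Carrier → Carrier
    ⁻¹-inverse : ∀ x → ¬ (x ≈ 0#) → x * x ⁻¹ ≈ 1#
    0≉1        : ¬ (0# ≈ 1#)

module FieldOps {c ℓ : Level} (F : Field c ℓ) where
  open Field F

  fromℕ : ℕ → Carrier
  fromℕ zero    = 0#
  fromℕ (suc n) = 1# + fromℕ n

  infixr 10 _^_
  _^_ : Carrier → ℕ → Carrier
  x ^ zero  = 1#
  x ^ suc n = x * (x ^ n)

  sumBelow : ℕ → (ℕ → Carrier) → Carrier
  sumBelow zero    f = 0#
  sumBelow (suc n) f = sumBelow n f + f n

  sumFin : (n : ℕ) → (Fin n → Carrier) → Carrier
  sumFin zero    f = 0#
  sumFin (suc n) f = f Fin.zero + sumFin n (λ i → f (Fin.suc i))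
    where import Data.Fin as Fin

  sumList : List Carrier → Carrier
  sumList []       = 0#
  sumList (a ∷ as) = a + sumList as

  binom : ℕ → ℕ → Carrier
  binom n k = fromℕ (n C k)

  -- Multiplying the defining identity
  --   ((1-μ)/(e^t-μ))^n e^{xt} = Σ_j H_j^{(n)}(x|μ) t^j/j!
  -- by (e^t-μ)^n = Σ_{r=0}^n C(n,r) (-μ)^{n-r} e^{rt} and comparing
  -- coefficients of t^N/N! gives, for every N,
  --   Σ_{j=0}^{N} C(N,j) H_j · Σ_{r=0}^{n} C(n,r)(-μ)^{n-r} r^{N-j} = (1-μ)^n x^N.
  -- The coefficient of H_N is (1-μ)^n, so (for μ ≠ 1) this determines H_N:
  --   H_N = (1-μ)^{-n} ( (1-μ)^n x^N
  --          - Σ_{j<N} C(N,j) H_j Σ_{r=0}^{n} C(n,r)(-μ)^{n-r} r^{N-j} ).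

  -- Σ_{r=0}^{n} C(n,r) (-μ)^{n-r} r^e   (coefficient of t^e/e! in (e^t-μ)^n)
  expCoeff : ℕ → Carrier → ℕ → Carrier
  expCoeff n μ e = sumBelow (suc n) (λ r → binom n r * ((- μ) ^ (n ∸ r)) * (fromℕ r ^ e))

  FEnext : (n : ℕ) → Carrier → Carrier → (N : ℕ) → Vec Carrier N → Carrier
  FEnext n μ x N prev =
    ((1# - μ) ^ n) ⁻¹ *
      ((1# - μ) ^ n * (x ^ N)
       - sumFin N (λ j → binom N (toℕ j) * lookup prev j * expCoeff n μ (N ∸ toℕ j)))

  FEvec : (n : ℕ) → Carrier → Carrier → (N : ℕ) → Vec Carrier N
  FEvec n μ x zero    = []
  FEvec n μ x (suc N) = FEvec n μ x N ∷ʳ FEnext n μ x N (FEvec n μ x N)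

  FrobeniusEuler : (n : ℕ) → (x μ : Carrier) → (j : ℕ) → Carrier
  FrobeniusEuler n x μ j = FEnext n μ x j (FEvec n μ x j)

  compositions : ℕ → ℕ → List (List ℕ)
  compositions zero    zero    = [] ∷ []
  compositions zero    (suc n) = []
  compositions (suc m) n =
    concatMap (λ v → map (v ∷_) (compositions m (n ∸ v))) (upTo (suc n))

  weightFrom : ℕ → List ℕ → ℕ
  weightFrom w []       = 0
  weightFrom w (v ∷ vs) = w ℕ.* v ℕ.+ weightFrom (suc w) vs

  factProd : List ℕ → ℕ
  factProd []       = 1
  factProd (v ∷ vs) = v ℕ.! ℕ.* factProd vs

  factProd≢0 : ∀ vs → NonZero (factProd vs)
  factProd≢0 []       = _
  factProd≢0 (v ∷ vs) = m*n≢0 (v ℕ.!) (factProd vs) {{v !≢0}} {{factProd≢0 vs}}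

  multinomial : ℕ → List ℕ → ℕ
  multinomial n vs = ℕ._/_ (n ℕ.!) (factProd vs) {{factProd≢0 vs}}

  S : (k n m : ℕ) → Carrier → Carrier
  S k n m l = sumList (map term (compositions m n))
    where
      term : List ℕ → Carrier
      term vs = fromℕ (multinomial n vs) * ((l ⁻¹) ^ weightFrom 1 vs) * (fromℕ (weightFrom 1 vs) ^ k)

CharZero : ∀ {c ℓ} → Field c ℓ → Set ℓ
CharZero F = ∀ n → ¬ (fromℕ (suc n) ≈ 0#)
  where open Field F
        open FieldOps F

module Submission where

-- Work with exponential generating functions: coefficient sequences under the binomial
-- product. The recursion defining H^{(n)}(x|μ) says exactly that H(t) (eᵗ - μ)ⁿ = (1 - μ)ⁿ e^{xt},
-- and this determines H because the constant term (1 - μ)ⁿ is invertible. By the multinomial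
-- theorem Σ_k S_k^{(n)}(m|λ) tᵏ/k! = (Σ_{i=1}^m λ⁻ⁱ e^{it})ⁿ, and by telescoping
-- (Σ_{i=1}^m λ⁻ⁱ e^{it}) e⁻ᵗ (eᵗ - λ) = λ⁻ᵐ (e^{mt} - λᵐ). Hence, with K = ((1-λ)/(1-λᵐ))ⁿ λ^{mn},
-- the series K S(t) e^{-nt} H^{(n)}(x/m|λᵐ)(mt) satisfies the defining equation of H^{(n)}(x|λ);
-- comparing coefficients of t^N/N! gives the formula for every N, the theorem being N = n - 1.

open import Defs
open import Level using (Level)
open import Function using (id)
open import Data.Product using (_,_)
open import Data.Nat as ℕ using (ℕ; zero; suc; _≤_; _<_; _∸_)
  renaming (_*_ to _*ℕ_; _+_ to _+ℕ_)
import Data.Nat.Properties as ℕ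
import Data.Nat.Solver as NatSolver
open import Data.Nat.Induction using (<-rec)
open import Data.Nat.DivMod using (m/n*n≡m; m*n/n≡m)
open import Data.Nat.Combinatorics
  using (_C_; nCk+nC[k+1]≡[n+1]C[k+1]; k>n⇒nCk≡0; nCn≡1; nCk≡n!/k![n-k]!; k![n∸k]!∣n!)
open import Data.Fin as Fin using (Fin; toℕ)
import Data.Fin.Properties as Fin
open import Data.Fin.Relation.Unary.Top using (view; ‵fromℕ; ‵inj₁)
open import Data.Vec using (Vec; []; _∷_; lookup; _∷ʳ_)
open import Data.List using (List; []; _∷_; map; concatMap; applyUpTo; upTo; _++_)
open import Data.List.Relation.Unary.All as All using (All; []; _∷_)
import Data.List.Relation.Unary.All.Properties as All
open import Relation.Nullary using (¬_)
open import Relation.Binary.PropositionalEquality as ≡ using (_≡_)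
open import Relation.Binary.Structures using (IsEquivalence)
import Relation.Binary.Reasoning.Setoid as SetoidReasoning
open import Algebra.Bundles using (CommutativeSemiring)
open import Algebra.Structures.Biased using (IsCommutativeSemiringˡ)
import Algebra.Properties.Ring as RingProperties
import Algebra.Properties.Group as GroupProperties
import Algebra.Properties.AbelianGroup as AbelianGroupProperties
import Algebra.Properties.CommutativeSemigroup as CommSemigroupProperties
import Algebra.Properties.Semiring.Mult as SemiringMult
import Algebra.Properties.Semiring.Sum as SemiringSum
import Algebra.Properties.CommutativeSemiring.Exp as CommSemiringExp
import Algebra.Properties.CommutativeSemiring.Binomial as CommSemiringBinomial
import Algebra.Solver.Ring.NaturalCoefficients.Default as NaturalCoefficientsSolver

module FieldArithmetic {c ℓ : Level} (F : Field c ℓ) where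
  open Field F
  open FieldOps F
  open SetoidReasoning setoid
  open RingProperties ring public using (-‿distribˡ-*; -‿distribʳ-*)
  open GroupProperties +-group public using () renaming (∙-cancelˡ to +-cancelˡ)
  open GroupProperties +-group using (x∙y⁻¹≈ε⇒x≈y)
  private
    module Exp = CommSemiringExp commutativeSemiring
    module Mult = SemiringMult semiring

  ^≡Exp^ : ∀ x n → x ^ n ≡ x Exp.^ n
  ^≡Exp^ x zero    = ≡.refl
  ^≡Exp^ x (suc n) = ≡.cong (x *_) (^≡Exp^ x n)

  ^-congˡ : ∀ {x y} n → x ≈ y → x ^ n ≈ y ^ n
  ^-congˡ {x} {y} n x≈y rewrite ^≡Exp^ x n | ^≡Exp^ y n = Exp.^-congˡ n x≈y

  ^-homo-* : ∀ x i j → x ^ (i +ℕ j) ≈ x ^ i * x ^ j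
  ^-homo-* x i j rewrite ^≡Exp^ x (i +ℕ j) | ^≡Exp^ x i | ^≡Exp^ x j = Exp.^-homo-* x i j

  ^-assocʳ : ∀ x i j → (x ^ i) ^ j ≈ x ^ (i *ℕ j)
  ^-assocʳ x i j rewrite ^≡Exp^ (x ^ i) j | ^≡Exp^ x i | ^≡Exp^ x (i *ℕ j) = Exp.^-assocʳ x i j

  ^-distrib-* : ∀ x y n → (x * y) ^ n ≈ x ^ n * y ^ n
  ^-distrib-* x y n rewrite ^≡Exp^ (x * y) n | ^≡Exp^ x n | ^≡Exp^ y n = Exp.^-distrib-* x y n

  1^ : ∀ n → 1# ^ n ≈ 1#
  1^ zero    = refl
  1^ (suc n) = trans (*-identityˡ _) (1^ n)

  fromℕ≡×1 : ∀ n → fromℕ n ≡ n Mult.× 1#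
  fromℕ≡×1 zero    = ≡.refl
  fromℕ≡×1 (suc n) = ≡.cong (1# +_) (fromℕ≡×1 n)

  fromℕ-homo-+ : ∀ i j → fromℕ (i +ℕ j) ≈ fromℕ i + fromℕ j
  fromℕ-homo-+ i j rewrite fromℕ≡×1 (i +ℕ j) | fromℕ≡×1 i | fromℕ≡×1 j = Mult.×-homo-+ 1# i j

  fromℕ-homo-* : ∀ i j → fromℕ (i *ℕ j) ≈ fromℕ i * fromℕ j
  fromℕ-homo-* i j rewrite fromℕ≡×1 (i *ℕ j) | fromℕ≡×1 i | fromℕ≡×1 j = Mult.×1-homo-* i j

  ⁻¹-inverseˡ : ∀ {x} → ¬ (x ≈ 0#) → x ⁻¹ * x ≈ 1#
  ⁻¹-inverseˡ {x} x≉0 = trans (*-comm _ _) (⁻¹-inverse x x≉0)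

  *-cancelʳ : ∀ {x y z} → ¬ (z ≈ 0#) → x * z ≈ y * z → x ≈ y
  *-cancelʳ {x} {y} {z} z≉0 xz≈yz = begin
    x                ≈⟨ cancel x ⟨
    (x * z) * z ⁻¹   ≈⟨ *-congʳ xz≈yz ⟩
    (y * z) * z ⁻¹   ≈⟨ cancel y ⟩
    y                ∎
    where
    cancel : ∀ w → (w * z) * z ⁻¹ ≈ w
    cancel w = trans (*-assoc _ _ _) (trans (*-congˡ (⁻¹-inverse z z≉0)) (*-identityʳ w))

  *-nonzero : ∀ {x y} → ¬ (x ≈ 0#) → ¬ (y ≈ 0#) → ¬ (x * y ≈ 0#)
  *-nonzero {x} {y} x≉0 y≉0 xy≈0 = y≉0 (*-cancelʳ x≉0 (begin
    y * x  ≈⟨ *-comm y x ⟩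
    x * y  ≈⟨ xy≈0 ⟩
    0#     ≈⟨ zeroˡ x ⟨
    0# * x ∎))

  ^-nonzero : ∀ {x} n → ¬ (x ≈ 0#) → ¬ (x ^ n ≈ 0#)
  ^-nonzero zero    x≉0 1≈0 = 0≉1 (sym 1≈0)
  ^-nonzero (suc n) x≉0     = *-nonzero x≉0 (^-nonzero n x≉0)

  1-x≉0 : ∀ {x} → ¬ (x ≈ 1#) → ¬ (1# - x ≈ 0#)
  1-x≉0 x≉1 1-x≈0 = x≉1 (sym (x∙y⁻¹≈ε⇒x≈y 1# _ 1-x≈0))

  ⁻¹-*-cancelʳ : ∀ {x} y → ¬ (x ≈ 0#) → (x ⁻¹ * y) * x ≈ y
  ⁻¹-*-cancelʳ {x} y x≉0 = begin
    (x ⁻¹ * y) * x   ≈⟨ *-assoc _ _ _ ⟩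
    x ⁻¹ * (y * x)   ≈⟨ *-congˡ (*-comm y x) ⟩
    x ⁻¹ * (x * y)   ≈⟨ *-assoc _ _ _ ⟨
    (x ⁻¹ * x) * y   ≈⟨ *-congʳ (⁻¹-inverseˡ x≉0) ⟩
    1# * y           ≈⟨ *-identityˡ y ⟩
    y                ∎

  ⁻¹-^-inverseˡ : ∀ {x} n → ¬ (x ≈ 0#) → (x ⁻¹) ^ n * x ^ n ≈ 1#
  ⁻¹-^-inverseˡ {x} n x≉0 =
    trans (sym (^-distrib-* (x ⁻¹) x n)) (trans (^-congˡ n (⁻¹-inverseˡ x≉0)) (1^ n))

module FiniteSums {c ℓ : Level} (F : Field c ℓ) where
  open Field F
  open FieldOps F
  open CommSemigroupProperties +-commutativeSemigroup public using () renaming (interchange to +-interchange)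

  sumBelow-cong : ∀ n {f g : ℕ → Carrier} → (∀ i → f i ≈ g i) → sumBelow n f ≈ sumBelow n g
  sumBelow-cong zero    f≈g = refl
  sumBelow-cong (suc n) f≈g = +-cong (sumBelow-cong n f≈g) (f≈g n)

  sumBelow-cong-< : ∀ n {f g : ℕ → Carrier} → (∀ {i} → i < n → f i ≈ g i) → sumBelow n f ≈ sumBelow n g
  sumBelow-cong-< zero    f≈g = refl
  sumBelow-cong-< (suc n) f≈g = +-cong (sumBelow-cong-< n (λ i<n → f≈g (ℕ.m<n⇒m<1+n i<n))) (f≈g (ℕ.n<1+n n))

  sumBelow-+ : ∀ n (f g : ℕ → Carrier) → sumBelow n (λ i → f i + g i) ≈ sumBelow n f + sumBelow n g
  sumBelow-+ zero    f g = sym (+-identityˡ 0#)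
  sumBelow-+ (suc n) f g = trans (+-congʳ (sumBelow-+ n f g)) (+-interchange _ _ (f n) (g n))

  *-distribˡ-sumBelow : ∀ n x (f : ℕ → Carrier) → x * sumBelow n f ≈ sumBelow n (λ i → x * f i)
  *-distribˡ-sumBelow zero    x f = zeroʳ x
  *-distribˡ-sumBelow (suc n) x f = trans (distribˡ _ _ _) (+-congʳ (*-distribˡ-sumBelow n x f))

  *-distribʳ-sumBelow : ∀ n x (f : ℕ → Carrier) → sumBelow n f * x ≈ sumBelow n (λ i → f i * x)
  *-distribʳ-sumBelow n x f =
    trans (*-comm _ _) (trans (*-distribˡ-sumBelow n x f) (sumBelow-cong n (λ i → *-comm x (f i))))

  sumBelow-suc : ∀ n (f : ℕ → Carrier) → sumBelow (suc n) f ≈ f 0 + sumBelow n (λ i → f (suc i))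
  sumBelow-suc zero    f = trans (+-identityˡ _) (sym (+-identityʳ _))
  sumBelow-suc (suc n) f = trans (+-congʳ (sumBelow-suc n f)) (+-assoc _ _ _)

  sumBelow-telescope : ∀ (u : ℕ → Carrier) n → sumBelow n (λ i → u (suc i) - u i) ≈ u n - u 0
  sumBelow-telescope u zero    = sym (-‿inverseʳ (u 0))
  sumBelow-telescope u (suc n) = begin
    sumBelow n (λ i → u (suc i) - u i) + (u (suc n) - u n)
      ≈⟨ +-congʳ (sumBelow-telescope u n) ⟩
    (u n - u 0) + (u (suc n) - u n)
      ≈⟨ solve 4 (λ a a₀ b a′ → (a :+ a₀) :+ (b :+ a′) := (a :+ a′) :+ (b :+ a₀)) refl
               (u n) (- u 0) (u (suc n)) (- u n) ⟩
    (u n - u n) + (u (suc n) - u 0)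
      ≈⟨ trans (+-congʳ (-‿inverseʳ (u n))) (+-identityˡ _) ⟩
    u (suc n) - u 0 ∎
    where
    open SetoidReasoning setoid
    open NaturalCoefficientsSolver commutativeSemiring

  sumFin-cong : ∀ n {f g : Fin n → Carrier} → (∀ i → f i ≈ g i) → sumFin n f ≈ sumFin n g
  sumFin-cong zero    f≈g = refl
  sumFin-cong (suc n) f≈g = +-cong (f≈g Fin.zero) (sumFin-cong n (λ i → f≈g (Fin.suc i)))

  sumFin-toℕ : ∀ n (f : ℕ → Carrier) → sumFin n (λ i → f (toℕ i)) ≈ sumBelow n f
  sumFin-toℕ zero    f = refl
  sumFin-toℕ (suc n) f = trans (+-congˡ (sumFin-toℕ n (λ i → f (suc i)))) (sym (sumBelow-suc n f))

  sumList-++ : ∀ {A : Set} (f : A → Carrier) xs ys →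
    sumList (map f (xs ++ ys)) ≈ sumList (map f xs) + sumList (map f ys)
  sumList-++ f []       ys = sym (+-identityˡ _)
  sumList-++ f (x ∷ xs) ys = trans (+-congˡ (sumList-++ f xs ys)) (sym (+-assoc _ _ _))

  sumList-concatMap : ∀ {A B : Set} (f : B → Carrier) (g : A → List B) xs →
    sumList (map f (concatMap g xs)) ≈ sumList (map (λ x → sumList (map f (g x))) xs)
  sumList-concatMap f g []       = refl
  sumList-concatMap f g (x ∷ xs) = trans (sumList-++ f (g x) (concatMap g xs)) (+-congˡ (sumList-concatMap f g xs))

  sumList-map : ∀ {A B : Set} (f : B → Carrier) (g : A → B) xs →
    sumList (map f (map g xs)) ≈ sumList (map (λ x → f (g x)) xs)
  sumList-map f g []       = refl
  sumList-map f g (x ∷ xs) = +-congˡ (sumList-map f g xs)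

  sumList-applyUpTo : ∀ (f : ℕ → Carrier) (g : ℕ → ℕ) n →
    sumList (map f (applyUpTo g n)) ≈ sumBelow n (λ i → f (g i))
  sumList-applyUpTo f g zero    = refl
  sumList-applyUpTo f g (suc n) =
    trans (+-congˡ (sumList-applyUpTo f (λ i → g (suc i)) n)) (sym (sumBelow-suc n (λ i → f (g i))))

  sumList-cong-All : ∀ {A : Set} {P : A → Set} {f g : A → Carrier} {xs} →
    All P xs → (∀ {x} → P x → f x ≈ g x) → sumList (map f xs) ≈ sumList (map g xs)
  sumList-cong-All []         f≈g = refl
  sumList-cong-All (px ∷ pxs) f≈g = +-cong (f≈g px) (sumList-cong-All pxs f≈g)

  *-distribˡ-sumList : ∀ {A : Set} x (f : A → Carrier) xs →
    x * sumList (map f xs) ≈ sumList (map (λ y → x * f y) xs)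
  *-distribˡ-sumList x f []       = zeroʳ x
  *-distribˡ-sumList x f (y ∷ ys) = trans (distribˡ _ _ _) (+-congˡ (*-distribˡ-sumList x f ys))

module ExponentialGeneratingFunctions {c ℓ : Level} (F : Field c ℓ) where
  open Field F
  open FieldOps F
  open FieldArithmetic F
  open FiniteSums F
  open SetoidReasoning setoid

  Seq : Set c
  Seq = ℕ → Carrier

  infix 4 _≋_
  _≋_ : Seq → Seq → Set ℓ
  a ≋ b = ∀ N → a N ≈ b N

  shift : Seq → Seq
  shift a N = a (suc N)

  infixl 6 _⊕_
  infixl 7 _⊛_
  infixr 8 _⊙_

  _⊕_ : Seq → Seq → Seq
  (a ⊕ b) N = a N + b N

  _⊙_ : Carrier → Seq → Seq
  (k ⊙ a) N = k * a N

  -- The product of exponential generating functions Σ a_N t^N / N!, defined through the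
  -- Leibniz rule (a b)′ = a′ b + a b′.
  _⊛_ : Seq → Seq → Seq
  (a ⊛ b) zero    = a 0 * b 0
  (a ⊛ b) (suc N) = (shift a ⊛ b) N + (a ⊛ shift b) N

  𝟘 : Seq
  𝟘 N = 0#

  exp : Carrier → Seq
  exp a N = a ^ N

  𝟙 : Seq
  𝟙 = exp 0#

  ≋-refl : ∀ {a} → a ≋ a
  ≋-refl N = refl

  ≋-sym : ∀ {a b} → a ≋ b → b ≋ a
  ≋-sym a≋b N = sym (a≋b N)

  ≋-trans : ∀ {a b d} → a ≋ b → b ≋ d → a ≋ d
  ≋-trans a≋b b≋d N = trans (a≋b N) (b≋d N)

  ⊕-cong : ∀ {a a′ b b′} → a ≋ a′ → b ≋ b′ → a ⊕ b ≋ a′ ⊕ b′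
  ⊕-cong a≋a′ b≋b′ N = +-cong (a≋a′ N) (b≋b′ N)

  ⊛-cong : ∀ {a a′ b b′} → a ≋ a′ → b ≋ b′ → a ⊛ b ≋ a′ ⊛ b′
  ⊛-cong a≋a′ b≋b′ zero    = *-cong (a≋a′ 0) (b≋b′ 0)
  ⊛-cong a≋a′ b≋b′ (suc N) =
    +-cong (⊛-cong (λ K → a≋a′ (suc K)) b≋b′ N) (⊛-cong a≋a′ (λ K → b≋b′ (suc K)) N)

  ⊛-comm : ∀ a b → a ⊛ b ≋ b ⊛ a
  ⊛-comm a b zero    = *-comm _ _
  ⊛-comm a b (suc N) = trans (+-comm _ _) (+-cong (⊛-comm a (shift b) N) (⊛-comm (shift a) b N))

  ⊛-distribʳ : ∀ d a b → (a ⊕ b) ⊛ d ≋ a ⊛ d ⊕ b ⊛ d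
  ⊛-distribʳ d a b zero    = distribʳ _ _ _
  ⊛-distribʳ d a b (suc N) =
    trans (+-cong (⊛-distribʳ d (shift a) (shift b) N) (⊛-distribʳ (shift d) a b N)) (+-interchange _ _ _ _)

  ⊛-distribˡ : ∀ d a b → d ⊛ (a ⊕ b) ≋ d ⊛ a ⊕ d ⊛ b
  ⊛-distribˡ d a b N =
    trans (⊛-comm d (a ⊕ b) N) (trans (⊛-distribʳ d a b N) (+-cong (⊛-comm a d N) (⊛-comm b d N)))

  ⊙-⊛-assoc : ∀ k a b → (k ⊙ a) ⊛ b ≋ k ⊙ (a ⊛ b)
  ⊙-⊛-assoc k a b zero    = *-assoc _ _ _
  ⊙-⊛-assoc k a b (suc N) =
    trans (+-cong (⊙-⊛-assoc k (shift a) b N) (⊙-⊛-assoc k a (shift b) N)) (sym (distribˡ _ _ _))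

  ⊛-⊙-comm : ∀ k a b → a ⊛ (k ⊙ b) ≋ k ⊙ (a ⊛ b)
  ⊛-⊙-comm k a b N = trans (⊛-comm a (k ⊙ b) N) (trans (⊙-⊛-assoc k b a N) (*-congˡ (⊛-comm b a N)))

  ⊛-zeroˡ : ∀ b → 𝟘 ⊛ b ≋ 𝟘
  ⊛-zeroˡ b zero    = zeroˡ _
  ⊛-zeroˡ b (suc N) = trans (+-cong (⊛-zeroˡ b N) (⊛-zeroˡ (shift b) N)) (+-identityˡ _)

  ⊛-identityˡ : ∀ b → 𝟙 ⊛ b ≋ b
  ⊛-identityˡ b zero    = *-identityˡ _
  ⊛-identityˡ b (suc N) =
    trans (+-cong (trans (⊛-cong (λ K → zeroˡ _) ≋-refl N) (⊛-zeroˡ b N)) (⊛-identityˡ (shift b) N))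
          (+-identityˡ _)

  ⊛-identityʳ : ∀ b → b ⊛ 𝟙 ≋ b
  ⊛-identityʳ b N = trans (⊛-comm b 𝟙 N) (⊛-identityˡ b N)

  ⊛-assoc : ∀ a b d → (a ⊛ b) ⊛ d ≋ a ⊛ (b ⊛ d)
  ⊛-assoc a b d zero    = *-assoc _ _ _
  ⊛-assoc a b d (suc N) = begin
    ((shift a ⊛ b ⊕ a ⊛ shift b) ⊛ d) N + ((a ⊛ b) ⊛ shift d) N
      ≈⟨ +-congʳ (⊛-distribʳ d _ _ N) ⟩
    ((shift a ⊛ b) ⊛ d) N + ((a ⊛ shift b) ⊛ d) N + ((a ⊛ b) ⊛ shift d) N
      ≈⟨ +-cong (+-cong (⊛-assoc (shift a) b d N) (⊛-assoc a (shift b) d N)) (⊛-assoc a b (shift d) N) ⟩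
    (shift a ⊛ (b ⊛ d)) N + (a ⊛ (shift b ⊛ d)) N + (a ⊛ (b ⊛ shift d)) N
      ≈⟨ trans (+-assoc _ _ _) (+-congˡ (sym (⊛-distribˡ a _ _ N))) ⟩
    (shift a ⊛ (b ⊛ d)) N + (a ⊛ (shift b ⊛ d ⊕ b ⊛ shift d)) N ∎

  exp-cong : ∀ {a b} → a ≈ b → exp a ≋ exp b
  exp-cong a≈b N = ^-congˡ N a≈b

  exp-⊛ : ∀ a b → exp a ⊛ exp b ≋ exp (a + b)
  exp-⊛ a b zero    = *-identityˡ _
  exp-⊛ a b (suc N) = begin
    ((a ⊙ exp a) ⊛ exp b) N + (exp a ⊛ (b ⊙ exp b)) N  ≈⟨ +-cong (⊙-⊛-assoc a _ _ N) (⊛-⊙-comm b _ _ N) ⟩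
    a * (exp a ⊛ exp b) N + b * (exp a ⊛ exp b) N      ≈⟨ distribʳ _ _ _ ⟨
    (a + b) * (exp a ⊛ exp b) N                        ≈⟨ *-congˡ (exp-⊛ a b N) ⟩
    (a + b) * (a + b) ^ N                              ∎

  egfSemiring : CommutativeSemiring c ℓ
  egfSemiring = record
    { Carrier = Seq ; _≈_ = _≋_ ; _+_ = _⊕_ ; _*_ = _⊛_ ; 0# = 𝟘 ; 1# = 𝟙
    ; isCommutativeSemiring = IsCommutativeSemiringˡ.isCommutativeSemiring (record
      { +-isCommutativeMonoid = record
        { isMonoid = record
          { isSemigroup = record
            { isMagma = record { isEquivalence = ≋-isEquivalence ; ∙-cong = ⊕-cong }
            ; assoc = λ a b d N → +-assoc _ _ _ }
          ; identity = (λ a N → +-identityˡ _) , (λ a N → +-identityʳ _) }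
        ; comm = λ a b N → +-comm _ _ }
      ; *-isCommutativeMonoid = record
        { isMonoid = record
          { isSemigroup = record
            { isMagma = record { isEquivalence = ≋-isEquivalence ; ∙-cong = ⊛-cong }
            ; assoc = ⊛-assoc }
          ; identity = ⊛-identityˡ , ⊛-identityʳ }
        ; comm = ⊛-comm }
      ; distribʳ = ⊛-distribʳ
      ; zeroˡ = ⊛-zeroˡ })
    }
    where
    ≋-isEquivalence : IsEquivalence _≋_
    ≋-isEquivalence = record { refl = ≋-refl ; sym = ≋-sym ; trans = ≋-trans }

  private
    module EGFExp = CommSemiringExp egfSemiring
    module EGFMult = SemiringMult (CommutativeSemiring.semiring egfSemiring)
    module EGFSum = SemiringSum (CommutativeSemiring.semiring egfSemiring)
    module EGFBinomial = CommSemiringBinomial egfSemiring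
  open EGFExp public using () renaming (_^_ to _^ₛ_; ^-congˡ to ^ₛ-congˡ; ^-distrib-* to ^ₛ-distrib-⊛)

  convolution : Seq → Seq → Seq
  convolution a b N = sumBelow (suc N) (λ j → binom N j * a j * b (N ∸ j))

  binom-zero : ∀ N → binom N 0 ≈ 1#
  binom-zero N = +-identityʳ 1#

  binom-diag : ∀ N → binom N N ≈ 1#
  binom-diag N = trans (reflexive (≡.cong fromℕ (nCn≡1 N))) (+-identityʳ 1#)

  binom-suc-diag : ∀ N → binom N (suc N) ≈ 0#
  binom-suc-diag N = reflexive (≡.cong fromℕ (k>n⇒nCk≡0 (ℕ.n<1+n N)))

  binom-pascal : ∀ N j → binom (suc N) (suc j) ≈ binom N j + binom N (suc j)
  binom-pascal N j = trans (reflexive (≡.cong fromℕ (≡.sym (nCk+nC[k+1]≡[n+1]C[k+1] N j))))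
                           (fromℕ-homo-+ (N C j) (N C suc j))

  convolution-last : ∀ a b N →
    convolution a b N ≈ sumBelow N (λ j → binom N j * a j * b (N ∸ j)) + a N * b 0
  convolution-last a b N = +-congˡ (*-cong (trans (*-congʳ (binom-diag N)) (*-identityˡ _))
                                           (reflexive (≡.cong b (ℕ.n∸n≡0 N))))

  convolution-suc : ∀ a b N →
    convolution a b (suc N) ≈ convolution (shift a) b N + convolution a (shift b) N
  convolution-suc a b N = begin
    convolution a b (suc N)
      ≈⟨ sumBelow-suc (suc N) _ ⟩
    binom (suc N) 0 * a 0 * b (suc N) + sumBelow (suc N) (λ j → binom (suc N) (suc j) * a (suc j) * b (N ∸ j))
      ≈⟨ +-cong (*-congʳ (*-congʳ (trans (binom-zero (suc N)) (sym (binom-zero N)))))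
                (trans (sumBelow-cong (suc N) (λ j → pascal-split j)) (sumBelow-+ (suc N) _ _)) ⟩
    first + (convolution (shift a) b N + rest)
      ≈⟨ trans (sym (+-assoc _ _ _)) (trans (+-congʳ (+-comm _ _)) (+-assoc _ _ _)) ⟩
    convolution (shift a) b N + (first + rest)
      ≈⟨ +-congˡ (+-congˡ rest≈) ⟩
    convolution (shift a) b N + (first + sumBelow N (λ j → binom N (suc j) * a (suc j) * shift b (N ∸ suc j)))
      ≈⟨ +-congˡ (sumBelow-suc N _) ⟨
    convolution (shift a) b N + convolution a (shift b) N ∎
    where
    pascal-split : ∀ j → binom (suc N) (suc j) * a (suc j) * b (N ∸ j)
                         ≈ binom N j * a (suc j) * b (N ∸ j) + binom N (suc j) * a (suc j) * b (N ∸ j)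
    pascal-split j = trans (*-congʳ (trans (*-congʳ (binom-pascal N j)) (distribʳ _ _ _))) (distribʳ _ _ _)
    first = binom N 0 * a 0 * b (suc N)
    rest  = sumBelow (suc N) (λ j → binom N (suc j) * a (suc j) * b (N ∸ j))
    rest≈ : rest ≈ sumBelow N (λ j → binom N (suc j) * a (suc j) * shift b (N ∸ suc j))
    rest≈ = begin
      rest
        ≈⟨ +-congˡ (trans (*-congʳ (trans (*-congʳ (binom-suc-diag N)) (zeroˡ _))) (zeroˡ _)) ⟩
      sumBelow N (λ j → binom N (suc j) * a (suc j) * b (N ∸ j)) + 0#
        ≈⟨ +-identityʳ _ ⟩
      sumBelow N (λ j → binom N (suc j) * a (suc j) * b (N ∸ j))
        ≈⟨ sumBelow-cong-< N (λ j<N → *-congˡ (reflexive (≡.cong b (ℕ.+-∸-assoc 1 j<N)))) ⟩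
      sumBelow N (λ j → binom N (suc j) * a (suc j) * shift b (N ∸ suc j)) ∎

  ⊛≋convolution : ∀ a b → a ⊛ b ≋ convolution a b
  ⊛≋convolution a b zero    = sym (trans (+-identityˡ _) (*-congʳ (trans (*-congʳ (binom-zero 0)) (*-identityˡ _))))
  ⊛≋convolution a b (suc N) =
    trans (+-cong (⊛≋convolution (shift a) b N) (⊛≋convolution a (shift b) N)) (sym (convolution-suc a b N))

  ⊛-cancelʳ : ∀ {a b} d → ¬ (d 0 ≈ 0#) → a ⊛ d ≋ b ⊛ d → a ≋ b
  ⊛-cancelʳ {a} {b} d d₀≉0 ad≋bd = <-rec (λ N → a N ≈ b N) step
    where
    step : ∀ N → (∀ {j} → j < N → a j ≈ b j) → a N ≈ b N
    step N a≈b = *-cancelʳ d₀≉0 (+-cancelˡ _ _ _ (begin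
      lower b + a N * d 0  ≈⟨ +-congʳ (sumBelow-cong-< N (λ j<N → *-congʳ (*-congˡ (sym (a≈b j<N))))) ⟩
      lower a + a N * d 0  ≈⟨ convolution-last a d N ⟨
      convolution a d N    ≈⟨ trans (sym (⊛≋convolution a d N)) (trans (ad≋bd N) (⊛≋convolution b d N)) ⟩
      convolution b d N    ≈⟨ convolution-last b d N ⟩
      lower b + b N * d 0  ∎))
      where
      lower : Seq → Carrier
      lower f = sumBelow N (λ j → binom N j * f j * d (N ∸ j))

  ⊛-sumList : ∀ {A : Set} b (t : A → Seq) xs N →
    (b ⊛ (λ K → sumList (map (λ x → t x K) xs))) N ≈ sumList (map (λ x → (b ⊛ t x) N) xs)
  ⊛-sumList b t []       N = trans (⊛-comm b 𝟘 N) (⊛-zeroˡ b N)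
  ⊛-sumList b t (x ∷ xs) N = trans (⊛-distribˡ b (t x) _ N) (+-congˡ (⊛-sumList b t xs N))

  sumBelow-⊛ : ∀ m (t : ℕ → Seq) b N →
    ((λ K → sumBelow m (λ i → t i K)) ⊛ b) N ≈ sumBelow m (λ i → (t i ⊛ b) N)
  sumBelow-⊛ zero    t b N = ⊛-zeroˡ b N
  sumBelow-⊛ (suc m) t b N = trans (⊛-distribʳ b _ (t m) N) (+-congʳ (sumBelow-⊛ m t b N))

  ⊛-⊛-explicit : ∀ a b d N → (a ⊛ b ⊛ d) N ≈
    sumBelow (suc N) (λ s → sumBelow (suc s) (λ k → binom N s * (binom s k * a k * b (s ∸ k)) * d (N ∸ s)))
  ⊛-⊛-explicit a b d N = begin
    (a ⊛ b ⊛ d) N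
      ≈⟨ ⊛≋convolution (a ⊛ b) d N ⟩
    sumBelow (suc N) (λ s → binom N s * (a ⊛ b) s * d (N ∸ s))
      ≈⟨ sumBelow-cong (suc N) (λ s → *-congʳ (*-congˡ (⊛≋convolution a b s))) ⟩
    sumBelow (suc N) (λ s → binom N s * convolution a b s * d (N ∸ s))
      ≈⟨ sumBelow-cong (suc N) (λ s →
           trans (*-congʳ (*-distribˡ-sumBelow (suc s) _ _)) (*-distribʳ-sumBelow (suc s) _ _)) ⟩
    sumBelow (suc N) (λ s → sumBelow (suc s) (λ k → binom N s * (binom s k * a k * b (s ∸ k)) * d (N ∸ s))) ∎

  ^ₛ-at-0 : ∀ a k → (a ^ₛ k) 0 ≈ a 0 ^ k
  ^ₛ-at-0 a zero    = refl
  ^ₛ-at-0 a (suc k) = *-congˡ (^ₛ-at-0 a k)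

  ⊙-^ₛ : ∀ k a j → (k ⊙ a) ^ₛ j ≋ (k ^ j) ⊙ (a ^ₛ j)
  ⊙-^ₛ k a zero    N = sym (*-identityˡ _)
  ⊙-^ₛ k a (suc j) N = begin
    ((k ⊙ a) ⊛ (k ⊙ a) ^ₛ j) N    ≈⟨ ⊛-cong ≋-refl (⊙-^ₛ k a j) N ⟩
    ((k ⊙ a) ⊛ (k ^ j) ⊙ a ^ₛ j) N ≈⟨ ⊙-⊛-assoc k a _ N ⟩
    k * (a ⊛ (k ^ j) ⊙ a ^ₛ j) N   ≈⟨ *-congˡ (⊛-⊙-comm _ a _ N) ⟩
    k * (k ^ j * (a ^ₛ suc j) N)   ≈⟨ *-assoc _ _ _ ⟨
    k ^ suc j * (a ^ₛ suc j) N     ∎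

  exp-^ₛ : ∀ a k → exp a ^ₛ k ≋ exp (fromℕ k * a)
  exp-^ₛ a zero    = exp-cong (sym (zeroˡ a))
  exp-^ₛ a (suc k) = ≋-trans (⊛-cong ≋-refl (exp-^ₛ a k))
    (≋-trans (exp-⊛ a _) (exp-cong (trans (+-congʳ (sym (*-identityˡ a))) (sym (distribʳ a 1# (fromℕ k))))))

  𝟙-^ₛ : ∀ k → 𝟙 ^ₛ k ≋ 𝟙
  𝟙-^ₛ k = ≋-trans (exp-^ₛ 0# k) (exp-cong (zeroʳ _))

  binomial-coefficient : ∀ a b n N →
    ((a ⊕ b) ^ₛ n) N ≈ sumBelow (suc n) (λ j → binom n j * (a ^ₛ j ⊛ b ^ₛ (n ∸ j)) N)
  binomial-coefficient a b n N = begin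
    ((a ⊕ b) ^ₛ n) N
      ≈⟨ EGFBinomial.theorem n a b N ⟩
    EGFSum.sum (EGFBinomial.binomialTerm a b n) N
      ≈⟨ sum-at (EGFBinomial.binomialTerm a b n) N ⟩
    sumFin (suc n) (λ i → EGFBinomial.binomialTerm a b n i N)
      ≈⟨ sumFin-cong (suc n) (λ i → ×-at (n C toℕ i) (a ^ₛ toℕ i ⊛ b ^ₛ (n ∸ toℕ i)) N) ⟩
    sumFin (suc n) (λ i → binom n (toℕ i) * (a ^ₛ toℕ i ⊛ b ^ₛ (n ∸ toℕ i)) N)
      ≈⟨ sumFin-toℕ (suc n) (λ j → binom n j * (a ^ₛ j ⊛ b ^ₛ (n ∸ j)) N) ⟩
    sumBelow (suc n) (λ j → binom n j * (a ^ₛ j ⊛ b ^ₛ (n ∸ j)) N) ∎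
    where
    ×-at : ∀ k a N → (k EGFMult.× a) N ≈ fromℕ k * a N
    ×-at zero    a N = sym (zeroˡ _)
    ×-at (suc k) a N = trans (+-congˡ (×-at k a N)) (trans (+-congʳ (sym (*-identityˡ _))) (sym (distribʳ _ _ _)))
    sum-at : ∀ {n} (v : Fin n → Seq) N → EGFSum.sum v N ≈ sumFin n (λ i → v i N)
    sum-at {zero}  v N = refl
    sum-at {suc n} v N = +-congˡ (sum-at (λ i → v (Fin.suc i)) N)

  dilate : Carrier → Seq → Seq
  dilate M a N = M ^ N * a N

  dilate-⊕ : ∀ M a b → dilate M (a ⊕ b) ≋ dilate M a ⊕ dilate M b
  dilate-⊕ M a b N = distribˡ _ _ _

  dilate-⊙ : ∀ M k a → dilate M (k ⊙ a) ≋ k ⊙ dilate M a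
  dilate-⊙ M k a N = trans (sym (*-assoc _ _ _)) (trans (*-congʳ (*-comm _ _)) (*-assoc _ _ _))

  dilate-exp : ∀ M a → dilate M (exp a) ≋ exp (M * a)
  dilate-exp M a N = sym (^-distrib-* M a N)

  dilate-𝟙 : ∀ M → dilate M 𝟙 ≋ 𝟙
  dilate-𝟙 M = ≋-trans (dilate-exp M 0#) (exp-cong (zeroʳ M))

  dilate-⊛ : ∀ M a b → dilate M (a ⊛ b) ≋ dilate M a ⊛ dilate M b
  dilate-⊛ M a b zero    = trans (*-identityˡ _) (sym (*-cong (*-identityˡ _) (*-identityˡ _)))
  dilate-⊛ M a b (suc N) = sym (begin
    (shift (dilate M a) ⊛ dilate M b) N + (dilate M a ⊛ shift (dilate M b)) N
      ≈⟨ +-cong (⊛-cong (λ K → *-assoc _ _ _) ≋-refl N) (⊛-cong ≋-refl (λ K → *-assoc _ _ _) N) ⟩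
    (M ⊙ dilate M (shift a) ⊛ dilate M b) N + (dilate M a ⊛ M ⊙ dilate M (shift b)) N
      ≈⟨ +-cong (⊙-⊛-assoc M _ _ N) (⊛-⊙-comm M _ _ N) ⟩
    M * (dilate M (shift a) ⊛ dilate M b) N + M * (dilate M a ⊛ dilate M (shift b)) N
      ≈⟨ +-cong (*-congˡ (dilate-⊛ M (shift a) b N)) (*-congˡ (dilate-⊛ M a (shift b) N)) ⟨
    M * (M ^ N * (shift a ⊛ b) N) + M * (M ^ N * (a ⊛ shift b) N)
      ≈⟨ trans (sym (distribˡ _ _ _)) (trans (*-congˡ (sym (distribˡ _ _ _))) (sym (*-assoc _ _ _))) ⟩
    dilate M (a ⊛ b) (suc N) ∎)

  dilate-^ₛ : ∀ M a k → dilate M (a ^ₛ k) ≋ dilate M a ^ₛ k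
  dilate-^ₛ M a zero    = dilate-𝟙 M
  dilate-^ₛ M a (suc k) = ≋-trans (dilate-⊛ M a _) (⊛-cong ≋-refl (dilate-^ₛ M a k))

  eᵗ-sub : Carrier → Seq
  eᵗ-sub μ = exp 1# ⊕ (- μ) ⊙ 𝟙

  dilate-eᵗ-sub : ∀ M μ → dilate M (eᵗ-sub μ) ≋ exp M ⊕ (- μ) ⊙ 𝟙
  dilate-eᵗ-sub M μ = ≋-trans (dilate-⊕ M (exp 1#) ((- μ) ⊙ 𝟙))
    (⊕-cong (≋-trans (dilate-exp M 1#) (exp-cong (*-identityʳ M)))
            (≋-trans (dilate-⊙ M (- μ) 𝟙) (λ N → *-congˡ (dilate-𝟙 M N))))

module FrobeniusEulerSeries {c ℓ : Level} (F : Field c ℓ) where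
  open Field F
  open FieldOps F
  open FieldArithmetic F
  open FiniteSums F
  open ExponentialGeneratingFunctions F
  open SetoidReasoning setoid
  open AbelianGroupProperties +-abelianGroup using (xyx⁻¹≈y)

  expCoeff≋eᵗ-sub^ₛ : ∀ n μ → expCoeff n μ ≋ eᵗ-sub μ ^ₛ n
  expCoeff≋eᵗ-sub^ₛ n μ N = sym (begin
    (eᵗ-sub μ ^ₛ n) N
      ≈⟨ binomial-coefficient (exp 1#) ((- μ) ⊙ 𝟙) n N ⟩
    sumBelow (suc n) (λ r → binom n r * (exp 1# ^ₛ r ⊛ ((- μ) ⊙ 𝟙) ^ₛ (n ∸ r)) N)
      ≈⟨ sumBelow-cong (suc n) (λ r → trans (*-congˡ (term r)) (sym (*-assoc _ _ _))) ⟩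
    expCoeff n μ N ∎)
    where
    term : ∀ r → (exp 1# ^ₛ r ⊛ ((- μ) ⊙ 𝟙) ^ₛ (n ∸ r)) N ≈ (- μ) ^ (n ∸ r) * fromℕ r ^ N
    term r = begin
      (exp 1# ^ₛ r ⊛ ((- μ) ⊙ 𝟙) ^ₛ (n ∸ r)) N
        ≈⟨ ⊛-cong (exp-^ₛ 1# r) (≋-trans (⊙-^ₛ (- μ) 𝟙 (n ∸ r)) (λ K → *-congˡ (𝟙-^ₛ (n ∸ r) K))) N ⟩
      (exp (fromℕ r * 1#) ⊛ ((- μ) ^ (n ∸ r)) ⊙ 𝟙) N
        ≈⟨ ⊛-⊙-comm _ _ 𝟙 N ⟩
      (- μ) ^ (n ∸ r) * (exp (fromℕ r * 1#) ⊛ 𝟙) N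
        ≈⟨ *-congˡ (trans (⊛-identityʳ _ N) (exp-cong (*-identityʳ _) N)) ⟩
      (- μ) ^ (n ∸ r) * fromℕ r ^ N ∎

  expCoeff-at-0 : ∀ n μ → expCoeff n μ 0 ≈ (1# - μ) ^ n
  expCoeff-at-0 n μ =
    trans (expCoeff≋eᵗ-sub^ₛ n μ 0) (trans (^ₛ-at-0 (eᵗ-sub μ) n) (^-congˡ n (+-congˡ (*-identityʳ _))))

  lookup-∷ʳ-last : ∀ {A : Set c} {N} (xs : Vec A N) y → lookup (xs ∷ʳ y) (Fin.fromℕ N) ≡ y
  lookup-∷ʳ-last []       y = ≡.refl
  lookup-∷ʳ-last (x ∷ xs) y = lookup-∷ʳ-last xs y

  lookup-∷ʳ-inject₁ : ∀ {A : Set c} {N} (xs : Vec A N) y i → lookup (xs ∷ʳ y) (Fin.inject₁ i) ≡ lookup xs i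
  lookup-∷ʳ-inject₁ (x ∷ xs) y Fin.zero    = ≡.refl
  lookup-∷ʳ-inject₁ (x ∷ xs) y (Fin.suc i) = lookup-∷ʳ-inject₁ xs y i

  lookup-FEvec : ∀ n μ x N (i : Fin N) → lookup (FEvec n μ x N) i ≡ FrobeniusEuler n x μ (toℕ i)
  lookup-FEvec n μ x (suc N) i with view i
  ... | ‵fromℕ    = ≡.trans (lookup-∷ʳ-last (FEvec n μ x N) _)
                            (≡.cong (FrobeniusEuler n x μ) (≡.sym (Fin.toℕ-fromℕ N)))
  ... | ‵inj₁ {i = j} _ = ≡.trans (lookup-∷ʳ-inject₁ (FEvec n μ x N) _ j)
                            (≡.trans (lookup-FEvec n μ x N j)
                                     (≡.cong (FrobeniusEuler n x μ) (≡.sym (Fin.toℕ-inject₁ j))))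

  FrobeniusEuler-recurrence : ∀ n μ x → ¬ (μ ≈ 1#) → ∀ N →
    convolution (FrobeniusEuler n x μ) (expCoeff n μ) N ≈ (1# - μ) ^ n * x ^ N
  FrobeniusEuler-recurrence n μ x μ≉1 N = begin
    convolution h D N        ≈⟨ convolution-last h D N ⟩
    P + h N * D 0            ≈⟨ +-congˡ (*-congˡ (expCoeff-at-0 n μ)) ⟩
    P + h N * c₀             ≈⟨ +-congˡ (⁻¹-*-cancelʳ _ (^-nonzero n (1-x≉0 μ≉1))) ⟩
    P + (c₀ * x ^ N - Pfin)  ≈⟨ +-congˡ (+-congˡ (-‿cong Pfin≈P)) ⟩
    P + (c₀ * x ^ N - P)     ≈⟨ trans (sym (+-assoc _ _ _)) (xyx⁻¹≈y P _) ⟩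
    c₀ * x ^ N               ∎
    where
    h = FrobeniusEuler n x μ
    D = expCoeff n μ
    c₀ = (1# - μ) ^ n
    P = sumBelow N (λ j → binom N j * h j * D (N ∸ j))
    Pfin = sumFin N (λ j → binom N (toℕ j) * lookup (FEvec n μ x N) j * D (N ∸ toℕ j))
    Pfin≈P : Pfin ≈ P
    Pfin≈P = trans (sumFin-cong N (λ j → *-congʳ (*-congˡ (reflexive (lookup-FEvec n μ x N j)))))
                   (sumFin-toℕ N (λ j → binom N j * h j * D (N ∸ j)))

  FrobeniusEuler-series : ∀ n μ x → ¬ (μ ≈ 1#) →
    FrobeniusEuler n x μ ⊛ eᵗ-sub μ ^ₛ n ≋ (1# - μ) ^ n ⊙ exp x
  FrobeniusEuler-series n μ x μ≉1 N = begin
    (FrobeniusEuler n x μ ⊛ eᵗ-sub μ ^ₛ n) N   ≈⟨ ⊛-cong ≋-refl (≋-sym (expCoeff≋eᵗ-sub^ₛ n μ)) N ⟩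
    (FrobeniusEuler n x μ ⊛ expCoeff n μ) N    ≈⟨ ⊛≋convolution _ _ N ⟩
    convolution (FrobeniusEuler n x μ) (expCoeff n μ) N ≈⟨ FrobeniusEuler-recurrence n μ x μ≉1 N ⟩
    (1# - μ) ^ n * x ^ N                       ∎

  FrobeniusEuler-unique : ∀ n μ x {G} → ¬ (μ ≈ 1#) →
    G ⊛ eᵗ-sub μ ^ₛ n ≋ (1# - μ) ^ n ⊙ exp x → G ≋ FrobeniusEuler n x μ
  FrobeniusEuler-unique n μ x μ≉1 G-series = ⊛-cancelʳ (eᵗ-sub μ ^ₛ n) leading≉0
    (≋-trans G-series (≋-sym (FrobeniusEuler-series n μ x μ≉1)))
    where
    leading≉0 : ¬ ((eᵗ-sub μ ^ₛ n) 0 ≈ 0#)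
    leading≉0 e₀≈0 = ^-nonzero n (1-x≉0 μ≉1)
      (trans (sym (expCoeff-at-0 n μ)) (trans (expCoeff≋eᵗ-sub^ₛ n μ 0) e₀≈0))

  dilated-FrobeniusEuler-series : ∀ n μ x {M} → ¬ (M ≈ 0#) → ¬ (μ ≈ 1#) →
    dilate M (FrobeniusEuler n (x * M ⁻¹) μ) ⊛ dilate M (eᵗ-sub μ) ^ₛ n ≋ (1# - μ) ^ n ⊙ exp x
  dilated-FrobeniusEuler-series n μ x {M} M≉0 μ≉1 N = begin
    (dilate M H ⊛ dilate M (eᵗ-sub μ) ^ₛ n) N     ≈⟨ ⊛-cong ≋-refl (≋-sym (dilate-^ₛ M (eᵗ-sub μ) n)) N ⟩
    (dilate M H ⊛ dilate M (eᵗ-sub μ ^ₛ n)) N     ≈⟨ dilate-⊛ M H _ N ⟨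
    M ^ N * (H ⊛ eᵗ-sub μ ^ₛ n) N                 ≈⟨ *-congˡ (FrobeniusEuler-series n μ (x * M ⁻¹) μ≉1 N) ⟩
    M ^ N * ((1# - μ) ^ n * (x * M ⁻¹) ^ N)       ≈⟨ dilate-⊙ M _ (exp (x * M ⁻¹)) N ⟩
    (1# - μ) ^ n * (M ^ N * (x * M ⁻¹) ^ N)       ≈⟨ *-congˡ (trans (dilate-exp M _ N) (exp-cong M[xM⁻¹]≈x N)) ⟩
    (1# - μ) ^ n * x ^ N                          ∎
    where
    H = FrobeniusEuler n (x * M ⁻¹) μ
    M[xM⁻¹]≈x : M * (x * M ⁻¹) ≈ x
    M[xM⁻¹]≈x = trans (*-comm _ _) (trans (*-assoc _ _ _) (trans (*-congˡ (⁻¹-inverseˡ M≉0)) (*-identityʳ x)))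

module Multinomials {c ℓ : Level} (F : Field c ℓ) where
  open FieldOps F using (multinomial; factProd; factProd≢0; compositions)
  open ≡.≡-Reasoning
  open NatSolver.+-*-Solver

  -- multinomial is defined by truncating division; on compositions of n it is exact.
  ExactMultinomial : ℕ → List ℕ → Set
  ExactMultinomial n vs = multinomial n vs *ℕ factProd vs ≡ n ℕ.!

  n!≡nCv*v!*[n∸v]! : ∀ {n v} → v ≤ n → n ℕ.! ≡ (n C v) *ℕ (v ℕ.! *ℕ (n ∸ v) ℕ.!)
  n!≡nCv*v!*[n∸v]! {n} {v} v≤n = ≡.sym (begin
    (n C v) *ℕ (v ℕ.! *ℕ (n ∸ v) ℕ.!)
      ≡⟨ ≡.cong (_*ℕ (v ℕ.! *ℕ (n ∸ v) ℕ.!)) (nCk≡n!/k![n-k]! v≤n) ⟩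
    ℕ._/_ (n ℕ.!) (v ℕ.! *ℕ (n ∸ v) ℕ.!) {{ℕ._!*_!≢0 v (n ∸ v)}} *ℕ (v ℕ.! *ℕ (n ∸ v) ℕ.!)
      ≡⟨ m/n*n≡m {{ℕ._!*_!≢0 v (n ∸ v)}} (k![n∸k]!∣n! v≤n) ⟩
    n ℕ.! ∎)

  n!≡nCv*multinomial*factProd : ∀ {n v vs} → v ≤ n → ExactMultinomial (n ∸ v) vs →
    n ℕ.! ≡ ((n C v) *ℕ multinomial (n ∸ v) vs) *ℕ factProd (v ∷ vs)
  n!≡nCv*multinomial*factProd {n} {v} {vs} v≤n exact = begin
    n ℕ.!                                                ≡⟨ n!≡nCv*v!*[n∸v]! v≤n ⟩
    (n C v) *ℕ (v ℕ.! *ℕ (n ∸ v) ℕ.!)                    ≡⟨ ≡.cong (λ z → (n C v) *ℕ (v ℕ.! *ℕ z)) exact ⟨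
    (n C v) *ℕ (v ℕ.! *ℕ (q *ℕ factProd vs))
      ≡⟨ solve 4 (λ a b c d → a :* (b :* (c :* d)) := (a :* c) :* (b :* d)) ≡.refl (n C v) (v ℕ.!) q (factProd vs) ⟩
    ((n C v) *ℕ q) *ℕ (v ℕ.! *ℕ factProd vs)             ∎
    where
    q = multinomial (n ∸ v) vs

  multinomial-∷ : ∀ {n v vs} → v ≤ n → ExactMultinomial (n ∸ v) vs →
    multinomial n (v ∷ vs) ≡ (n C v) *ℕ multinomial (n ∸ v) vs
  multinomial-∷ {n} {v} {vs} v≤n exact =
    ≡.trans (≡.cong (λ z → ℕ._/_ z (factProd (v ∷ vs)) {{factProd≢0 (v ∷ vs)}})
                    (n!≡nCv*multinomial*factProd {n} {v} {vs} v≤n exact))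
            (m*n/n≡m _ (factProd (v ∷ vs)) {{factProd≢0 (v ∷ vs)}})

  exactMultinomial-∷ : ∀ {n v vs} → v ≤ n → ExactMultinomial (n ∸ v) vs → ExactMultinomial n (v ∷ vs)
  exactMultinomial-∷ {n} {v} {vs} v≤n exact =
    ≡.trans (≡.cong (_*ℕ factProd (v ∷ vs)) (multinomial-∷ {n} {v} {vs} v≤n exact))
            (≡.sym (n!≡nCv*multinomial*factProd {n} {v} {vs} v≤n exact))

  compositions-exact : ∀ m n → All (ExactMultinomial n) (compositions m n)
  compositions-exact zero    zero    = ≡.refl ∷ []
  compositions-exact zero    (suc n) = []
  compositions-exact (suc m) n = All.concat⁺ (All.map⁺ (All.applyUpTo⁺₁ id (suc n)
    (λ {v} v<1+n → All.map⁺ (All.map (λ {vs} → exactMultinomial-∷ {n} {v} {vs} (ℕ.s≤s⁻¹ v<1+n))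
                                      (compositions-exact m (n ∸ v))))))

module PowerSumSeries {c ℓ : Level} (F : Field c ℓ) (l : Field.Carrier F) where
  open Field F
  open FieldOps F
  open FieldArithmetic F
  open FiniteSums F
  open ExponentialGeneratingFunctions F
  open SetoidReasoning setoid
  open NaturalCoefficientsSolver commutativeSemiring
  open Multinomials F

  geometricTerm : ℕ → Seq
  geometricTerm w = (l ⁻¹) ^ w ⊙ exp (fromℕ w)

  geometricSum : ℕ → ℕ → Seq
  geometricSum m w N = sumBelow m (λ i → geometricTerm (w +ℕ i) N)

  geometricSum-suc : ∀ m w → geometricSum (suc m) w ≋ geometricTerm w ⊕ geometricSum m (suc w)
  geometricSum-suc m w N = trans (sumBelow-suc m (λ i → geometricTerm (w +ℕ i) N))
    (+-cong (reflexive (≡.cong (λ z → geometricTerm z N) (ℕ.+-identityʳ w)))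
            (sumBelow-cong m (λ i → reflexive (≡.cong (λ z → geometricTerm z N) (ℕ.+-suc w i)))))

  geometricTerm-^ₛ : ∀ w v → geometricTerm w ^ₛ v ≋ (l ⁻¹) ^ (w *ℕ v) ⊙ exp (fromℕ v * fromℕ w)
  geometricTerm-^ₛ w v = ≋-trans (⊙-^ₛ _ _ v) (λ N → *-cong (^-assocʳ (l ⁻¹) w v) (exp-^ₛ (fromℕ w) v N))

  powerSumTerm : ℕ → ℕ → List ℕ → Seq
  powerSumTerm n w vs N = fromℕ (multinomial n vs) * ((l ⁻¹) ^ weightFrom w vs) * (fromℕ (weightFrom w vs) ^ N)

  powerSumFrom : ℕ → ℕ → ℕ → Seq
  powerSumFrom m n w N = sumList (map (λ vs → powerSumTerm n w vs N) (compositions m n))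

  powerSumTerm-∷ : ∀ n w {v vs} → v ≤ n → ExactMultinomial (n ∸ v) vs →
    powerSumTerm n w (v ∷ vs) ≋ binom n v ⊙ (geometricTerm w ^ₛ v ⊛ powerSumTerm (n ∸ v) (suc w) vs)
  powerSumTerm-∷ n w {v} {vs} v≤n exact N = sym (begin
    binom n v * (geometricTerm w ^ₛ v ⊛ powerSumTerm (n ∸ v) (suc w) vs) N
      ≈⟨ *-congˡ (⊛-cong (geometricTerm-^ₛ w v) ≋-refl N) ⟩
    B * ((l ⁻¹) ^ (w *ℕ v) ⊙ exp (fromℕ v * fromℕ w) ⊛ (Q * (l ⁻¹) ^ W) ⊙ exp (fromℕ W)) N
      ≈⟨ *-congˡ (trans (⊙-⊛-assoc _ _ _ N) (*-congˡ (trans (⊛-⊙-comm _ _ _ N) (*-congˡ (exp-⊛ _ _ N))))) ⟩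
    B * ((l ⁻¹) ^ (w *ℕ v) * ((Q * (l ⁻¹) ^ W) * (fromℕ v * fromℕ w + fromℕ W) ^ N))
      ≈⟨ solve 5 (λ b q p₁ p₂ z → b :* (p₁ :* ((q :* p₂) :* z)) := (b :* q) :* (p₁ :* p₂) :* z) refl
               B Q ((l ⁻¹) ^ (w *ℕ v)) ((l ⁻¹) ^ W) ((fromℕ v * fromℕ w + fromℕ W) ^ N) ⟩
    (B * Q) * ((l ⁻¹) ^ (w *ℕ v) * (l ⁻¹) ^ W) * (fromℕ v * fromℕ w + fromℕ W) ^ N
      ≈⟨ *-cong (*-cong multinomial≈ (sym (^-homo-* (l ⁻¹) (w *ℕ v) W))) (^-congˡ N weight≈) ⟩
    powerSumTerm n w (v ∷ vs) N ∎)
    where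
    B = binom n v
    Q = fromℕ (multinomial (n ∸ v) vs)
    W = weightFrom (suc w) vs
    multinomial≈ : B * Q ≈ fromℕ (multinomial n (v ∷ vs))
    multinomial≈ = sym (trans (reflexive (≡.cong fromℕ (multinomial-∷ {n} {v} {vs} v≤n exact)))
                              (fromℕ-homo-* (n C v) (multinomial (n ∸ v) vs)))
    weight≈ : fromℕ v * fromℕ w + fromℕ W ≈ fromℕ (weightFrom w (v ∷ vs))
    weight≈ = sym (trans (fromℕ-homo-+ (w *ℕ v) W) (+-congʳ (trans (fromℕ-homo-* w v) (*-comm _ _))))

  sumList-compositions-suc : ∀ m n (f : List ℕ → Carrier) →
    sumList (map f (compositions (suc m) n))
      ≈ sumBelow (suc n) (λ v → sumList (map (λ vs → f (v ∷ vs)) (compositions m (n ∸ v))))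
  sumList-compositions-suc m n f =
    trans (sumList-concatMap f (λ v → map (v ∷_) (compositions m (n ∸ v))) (upTo (suc n)))
    (trans (sumList-applyUpTo _ id (suc n))
           (sumBelow-cong (suc n) (λ v → sumList-map f (v ∷_) (compositions m (n ∸ v)))))

  -- The multinomial theorem, proved one variable at a time.
  powerSumFrom≋geometricSum^ₛ : ∀ m n w → powerSumFrom m n w ≋ geometricSum m w ^ₛ n
  powerSumFrom≋geometricSum^ₛ zero    zero    w N =
    trans (+-identityʳ _) (trans (*-congʳ (trans (*-identityʳ _) (+-identityʳ 1#))) (*-identityˡ _))
  powerSumFrom≋geometricSum^ₛ zero    (suc n) w N = sym (⊛-zeroˡ _ N)
  powerSumFrom≋geometricSum^ₛ (suc m) n       w N = begin
    powerSumFrom (suc m) n w N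
      ≈⟨ sumList-compositions-suc m n (λ vs → powerSumTerm n w vs N) ⟩
    sumBelow (suc n) (λ v → sumList (map (λ vs → powerSumTerm n w (v ∷ vs) N) (compositions m (n ∸ v))))
      ≈⟨ sumBelow-cong-< (suc n) (λ {v} v<1+n → sumList-cong-All (compositions-exact m (n ∸ v))
           (λ {vs} exact → powerSumTerm-∷ n w {v} {vs} (ℕ.s≤s⁻¹ v<1+n) exact N)) ⟩
    sumBelow (suc n) (λ v → sumList (map (λ vs → binom n v * (gᵛ v ⊛ powerSumTerm (n ∸ v) (suc w) vs) N)
                                         (compositions m (n ∸ v))))
      ≈⟨ sumBelow-cong (suc n) (λ v → trans (sym (*-distribˡ-sumList (binom n v) _ (compositions m (n ∸ v))))
           (*-congˡ (sym (⊛-sumList (gᵛ v) (powerSumTerm (n ∸ v) (suc w)) (compositions m (n ∸ v)) N)))) ⟩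
    sumBelow (suc n) (λ v → binom n v * (gᵛ v ⊛ powerSumFrom m (n ∸ v) (suc w)) N)
      ≈⟨ sumBelow-cong (suc n) (λ v →
           *-congˡ (⊛-cong ≋-refl (powerSumFrom≋geometricSum^ₛ m (n ∸ v) (suc w)) N)) ⟩
    sumBelow (suc n) (λ v → binom n v * (gᵛ v ⊛ geometricSum m (suc w) ^ₛ (n ∸ v)) N)
      ≈⟨ binomial-coefficient (geometricTerm w) (geometricSum m (suc w)) n N ⟨
    ((geometricTerm w ⊕ geometricSum m (suc w)) ^ₛ n) N
      ≈⟨ ^ₛ-congˡ n (≋-sym (geometricSum-suc m w)) N ⟩
    (geometricSum (suc m) w ^ₛ n) N ∎
    where
    gᵛ : ℕ → Seq
    gᵛ v = geometricTerm w ^ₛ v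

  powerSum-series : ∀ m n → (λ k → S k n m l) ≋ geometricSum m 1 ^ₛ n
  powerSum-series m n = powerSumFrom≋geometricSum^ₛ m n 1

  geometricTerm-suc-⊛ : ¬ (l ≈ 0#) → ∀ i →
    geometricTerm (suc i) ⊛ (exp (- 1#) ⊛ eᵗ-sub l) ≋ (λ N → geometricTerm (suc i) N - geometricTerm i N)
  geometricTerm-suc-⊛ l≉0 i N = begin
    (g (suc i) ⊛ (exp (- 1#) ⊛ eᵗ-sub l)) N
      ≈⟨ ⊛-cong ≋-refl e⁻ᵗ[eᵗ-l] N ⟩
    (g (suc i) ⊛ (𝟙 ⊕ (- l) ⊙ exp (- 1#))) N
      ≈⟨ ⊛-distribˡ (g (suc i)) 𝟙 _ N ⟩
    (g (suc i) ⊛ 𝟙) N + (g (suc i) ⊛ (- l) ⊙ exp (- 1#)) N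
      ≈⟨ +-cong (⊛-identityʳ _ N)
                (trans (⊛-⊙-comm (- l) _ _ N) (*-congˡ (trans (⊙-⊛-assoc _ _ _ N) (*-congˡ (exp-⊛ _ _ N))))) ⟩
    g (suc i) N + - l * ((l ⁻¹) ^ suc i * (fromℕ (suc i) + - 1#) ^ N)
      ≈⟨ +-congˡ (trans (sym (*-assoc _ _ _)) (*-cong -l*l⁻ⁱ⁻¹≈-l⁻ⁱ (^-congˡ N 1+i-1≈i))) ⟩
    g (suc i) N + - ((l ⁻¹) ^ i) * fromℕ i ^ N
      ≈⟨ +-congˡ (-‿distribˡ-* _ _) ⟨
    g (suc i) N - g i N ∎
    where
    g = geometricTerm
    e⁻ᵗ[eᵗ-l] : exp (- 1#) ⊛ eᵗ-sub l ≋ 𝟙 ⊕ (- l) ⊙ exp (- 1#)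
    e⁻ᵗ[eᵗ-l] = ≋-trans (⊛-distribˡ (exp (- 1#)) (exp 1#) ((- l) ⊙ 𝟙))
      (⊕-cong (≋-trans (exp-⊛ (- 1#) 1#) (exp-cong (-‿inverseˡ 1#)))
              (≋-trans (⊛-⊙-comm (- l) _ 𝟙) (λ K → *-congˡ (⊛-identityʳ _ K))))
    -l*l⁻ⁱ⁻¹≈-l⁻ⁱ : - l * (l ⁻¹) ^ suc i ≈ - ((l ⁻¹) ^ i)
    -l*l⁻ⁱ⁻¹≈-l⁻ⁱ = begin
      - l * (l ⁻¹ * (l ⁻¹) ^ i)    ≈⟨ -‿distribˡ-* _ _ ⟨
      - (l * (l ⁻¹ * (l ⁻¹) ^ i))  ≈⟨ -‿cong (*-assoc _ _ _) ⟨
      - (l * l ⁻¹ * (l ⁻¹) ^ i)    ≈⟨ -‿cong (trans (*-congʳ (⁻¹-inverse l l≉0)) (*-identityˡ _)) ⟩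
      - ((l ⁻¹) ^ i)               ∎
    1+i-1≈i : (1# + fromℕ i) + - 1# ≈ fromℕ i
    1+i-1≈i = trans (+-congʳ (+-comm _ _)) (trans (+-assoc _ _ _) (trans (+-congˡ (-‿inverseʳ 1#)) (+-identityʳ _)))

  geometricSum-telescope : ¬ (l ≈ 0#) → ∀ m →
    geometricSum m 1 ⊛ exp (- 1#) ⊛ eᵗ-sub l ≋ (l ⁻¹) ^ m ⊙ dilate (fromℕ m) (eᵗ-sub (l ^ m))
  geometricSum-telescope l≉0 m N = begin
    (geometricSum m 1 ⊛ exp (- 1#) ⊛ eᵗ-sub l) N
      ≈⟨ ⊛-assoc (geometricSum m 1) _ _ N ⟩
    (geometricSum m 1 ⊛ (exp (- 1#) ⊛ eᵗ-sub l)) N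
      ≈⟨ sumBelow-⊛ m (λ i → geometricTerm (suc i)) _ N ⟩
    sumBelow m (λ i → (geometricTerm (suc i) ⊛ (exp (- 1#) ⊛ eᵗ-sub l)) N)
      ≈⟨ sumBelow-cong m (λ i → geometricTerm-suc-⊛ l≉0 i N) ⟩
    sumBelow m (λ i → geometricTerm (suc i) N - geometricTerm i N)
      ≈⟨ sumBelow-telescope (λ i → geometricTerm i N) m ⟩
    L * fromℕ m ^ N - 1# * 0# ^ N
      ≈⟨ +-congˡ (-‿cong (*-congʳ (⁻¹-^-inverseˡ m l≉0)) ) ⟨
    L * fromℕ m ^ N - L * l ^ m * 0# ^ N
      ≈⟨ +-congˡ (trans (-‿cong (*-assoc _ _ _)) (trans (-‿distribʳ-* _ _) (*-congˡ (-‿distribˡ-* _ _)))) ⟩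
    L * fromℕ m ^ N + L * (- (l ^ m) * 0# ^ N)
      ≈⟨ distribˡ _ _ _ ⟨
    L * (exp (fromℕ m) ⊕ (- (l ^ m)) ⊙ 𝟙) N
      ≈⟨ *-congˡ (dilate-eᵗ-sub (fromℕ m) (l ^ m) N) ⟨
    ((l ⁻¹) ^ m ⊙ dilate (fromℕ m) (eᵗ-sub (l ^ m))) N ∎
    where
    L = (l ⁻¹) ^ m

module MultiplicationFormula {c ℓ : Level} (F : Field c ℓ) where
  open Field F
  open FieldOps F
  open FieldArithmetic F
  open FiniteSums F
  open ExponentialGeneratingFunctions F
  open FrobeniusEulerSeries F
  open SetoidReasoning setoid
  open NaturalCoefficientsSolver commutativeSemiring

  multiplication-constant : ∀ m n l → ¬ (l ≈ 0#) → ¬ (l ^ m ≈ 1#) →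
    ((1# - l) * (1# - l ^ m) ⁻¹) ^ n * l ^ (m *ℕ n) * (((l ⁻¹) ^ m) ^ n * (1# - l ^ m) ^ n) ≈ (1# - l) ^ n
  multiplication-constant m n l l≉0 lᵐ≉1 = begin
    ((1# - l) * B ⁻¹) ^ n * l ^ (m *ℕ n) * (L ^ n * B ^ n)
      ≈⟨ *-congʳ (*-cong (^-distrib-* _ _ n) (sym (^-assocʳ l m n))) ⟩
    A ^ n * (B ⁻¹) ^ n * (l ^ m) ^ n * (L ^ n * B ^ n)
      ≈⟨ solve 5 (λ a b⁻¹ lᵐ l⁻ᵐ b → a :* b⁻¹ :* lᵐ :* (l⁻ᵐ :* b) := a :* (b⁻¹ :* b) :* (l⁻ᵐ :* lᵐ)) refl
               (A ^ n) ((B ⁻¹) ^ n) ((l ^ m) ^ n) (L ^ n) (B ^ n) ⟩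
    A ^ n * ((B ⁻¹) ^ n * B ^ n) * (L ^ n * (l ^ m) ^ n)
      ≈⟨ *-cong (*-congˡ (⁻¹-^-inverseˡ n (1-x≉0 lᵐ≉1)))
                (trans (sym (^-distrib-* _ _ n)) (trans (^-congˡ n (⁻¹-^-inverseˡ m l≉0)) (1^ n))) ⟩
    A ^ n * 1# * 1#
      ≈⟨ trans (*-identityʳ _) (*-identityʳ _) ⟩
    A ^ n ∎
    where
    A = 1# - l
    B = 1# - l ^ m
    L = (l ⁻¹) ^ m

  multiplicationSeries : ℕ → ℕ → Carrier → Carrier → Seq
  multiplicationSeries m n l x =
    (((1# - l) * (1# - l ^ m) ⁻¹) ^ n * l ^ (m *ℕ n))
      ⊙ ((λ k → S k n m l) ⊛ exp (- fromℕ n) ⊛ dilate (fromℕ m) (FrobeniusEuler n (x * fromℕ m ⁻¹) (l ^ m)))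

  multiplicationSeries-series : ∀ m n l x → ¬ (fromℕ m ≈ 0#) → ¬ (l ≈ 0#) → ¬ (l ^ m ≈ 1#) →
    multiplicationSeries m n l x ⊛ eᵗ-sub l ^ₛ n ≋ (1# - l) ^ n ⊙ exp x
  multiplicationSeries-series m n l x M≉0 l≉0 lᵐ≉1 N = begin
    (multiplicationSeries m n l x ⊛ eᵗ-sub l ^ₛ n) N
      ≈⟨ ⊙-⊛-assoc K _ _ N ⟩
    K * ((powerSums ⊛ exp (- fromℕ n) ⊛ dilatedH) ⊛ eᵗ-sub l ^ₛ n) N
      ≈⟨ *-congˡ (trans (⊛-cong (⊛-comm _ dilatedH) ≋-refl N) (⊛-assoc dilatedH _ _ N)) ⟩
    K * (dilatedH ⊛ (powerSums ⊛ exp (- fromℕ n) ⊛ eᵗ-sub l ^ₛ n)) N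
      ≈⟨ *-congˡ (⊛-cong ≋-refl (≋-trans factor (^ₛ-congˡ n (geometricSum-telescope l≉0 m))) N) ⟩
    K * (dilatedH ⊛ (L ⊙ dilate M (eᵗ-sub (l ^ m))) ^ₛ n) N
      ≈⟨ *-congˡ (trans (⊛-cong ≋-refl (⊙-^ₛ L _ n) N) (⊛-⊙-comm _ dilatedH _ N)) ⟩
    K * (L ^ n * (dilatedH ⊛ dilate M (eᵗ-sub (l ^ m)) ^ₛ n) N)
      ≈⟨ *-congˡ (*-congˡ (dilated-FrobeniusEuler-series n (l ^ m) x M≉0 lᵐ≉1 N)) ⟩
    K * (L ^ n * ((1# - l ^ m) ^ n * x ^ N))
      ≈⟨ trans (*-congˡ (sym (*-assoc _ _ _))) (sym (*-assoc _ _ _)) ⟩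
    K * (L ^ n * (1# - l ^ m) ^ n) * x ^ N
      ≈⟨ *-congʳ (multiplication-constant m n l l≉0 lᵐ≉1) ⟩
    (1# - l) ^ n * x ^ N ∎
    where
    open PowerSumSeries F l
    M = fromℕ m
    K = ((1# - l) * (1# - l ^ m) ⁻¹) ^ n * l ^ (m *ℕ n)
    L = (l ⁻¹) ^ m
    dilatedH = dilate M (FrobeniusEuler n (x * M ⁻¹) (l ^ m))
    powerSums : Seq
    powerSums k = S k n m l
    exp-nt≋ : exp (- fromℕ n) ≋ exp (- 1#) ^ₛ n
    exp-nt≋ = ≋-sym (≋-trans (exp-^ₛ (- 1#) n)
                             (exp-cong (trans (sym (-‿distribʳ-* _ _)) (-‿cong (*-identityʳ _)))))
    factor : powerSums ⊛ exp (- fromℕ n) ⊛ eᵗ-sub l ^ₛ n ≋ (geometricSum m 1 ⊛ exp (- 1#) ⊛ eᵗ-sub l) ^ₛ n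
    factor = ≋-trans (⊛-cong (⊛-cong (powerSum-series m n) exp-nt≋) ≋-refl)
      (≋-trans (⊛-cong (≋-sym (^ₛ-distrib-⊛ _ _ n)) ≋-refl) (≋-sym (^ₛ-distrib-⊛ _ _ n)))

  FrobeniusEuler-multiplication : ∀ m n l x → ¬ (fromℕ m ≈ 0#) → ¬ (l ≈ 0#) → ¬ (l ^ m ≈ 1#) → ∀ N →
    FrobeniusEuler n x l N
      ≈ ((1# - l) * (1# - l ^ m) ⁻¹) ^ n * l ^ (m *ℕ n)
        * sumBelow (suc N) (λ s → sumBelow (suc s) (λ k →
            binom s k * binom N s * (- fromℕ n) ^ (s ∸ k)
            * fromℕ m ^ (N ∸ s) * S k n m l
            * FrobeniusEuler n (x * fromℕ m ⁻¹) (l ^ m) (N ∸ s)))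
  FrobeniusEuler-multiplication m n l x M≉0 l≉0 lᵐ≉1 N = begin
    FrobeniusEuler n x l N
      ≈⟨ FrobeniusEuler-unique n l x l≉1 (multiplicationSeries-series m n l x M≉0 l≉0 lᵐ≉1) N ⟨
    multiplicationSeries m n l x N
      ≈⟨ *-congˡ (⊛-⊛-explicit _ _ _ N) ⟩
    _ * sumBelow (suc N) (λ s → sumBelow (suc s) (λ k →
          binom N s * (binom s k * S k n m l * (- fromℕ n) ^ (s ∸ k)) * (fromℕ m ^ (N ∸ s) * H (N ∸ s))))
      ≈⟨ *-congˡ (sumBelow-cong (suc N) (λ s → sumBelow-cong (suc s) (λ k →
           solve 6 (λ a b e p σ h → b :* (a :* σ :* e) :* (p :* h) := a :* b :* e :* p :* σ :* h) refl
             (binom s k) (binom N s) ((- fromℕ n) ^ (s ∸ k)) (fromℕ m ^ (N ∸ s)) (S k n m l) (H (N ∸ s))))) ⟩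
    _ ∎
    where
    H = FrobeniusEuler n (x * fromℕ m ⁻¹) (l ^ m)
    l≉1 : ¬ (l ≈ 1#)
    l≉1 l≈1 = lᵐ≉1 (trans (^-congˡ m l≈1) (1^ m))

theorem5 : ∀ {c ℓ} (F : Field c ℓ) → CharZero F →
    let open Field F
        open FieldOps F
    in (m n : ℕ) → 1 ≤ m → 1 ≤ n → (l x : Carrier) →
       ¬ (l ≈ 0#) → ¬ (l ^ m ≈ 1#) →
       FrobeniusEuler n x l (n ∸ 1)
         ≈ ((1# - l) * (1# - l ^ m) ⁻¹) ^ n * l ^ (m *ℕ n)
           * sumBelow n (λ s → sumBelow (suc s) (λ k →
               binom s k * binom (n ∸ 1) s * (- fromℕ n) ^ (s ∸ k)
               * fromℕ m ^ (n ∸ 1 ∸ s) * S k n m l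
               * FrobeniusEuler n (x * fromℕ m ⁻¹) (l ^ m) (n ∸ 1 ∸ s)))
theorem5 F charZero (suc m) (suc n) _ _ l x l≉0 lᵐ≉1 =
  MultiplicationFormula.FrobeniusEuler-multiplication F (suc m) (suc n) l x (charZero m) l≉0 lᵐ≉1 n
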